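{- Let $U=(V,E)$ and $U'=(V',E')$ be ubergraphs (of any finite depths), all of whose uberedges are non-empty. Then $U$ and $U'$ are isomorphic if and only if their uber-Levi graphs are isomorphic as directed graphs.
   Context: For a finite set $X$ define $P_0=X$ and $P_i=\mathcal{P}\left(\bigcup_{j=0}^{i-1}P_j\right)$ for $i\ge 1$, and set $\mathcal{P}(X)^k=\mathcal{P}\left(\bigcup_{i=0}^{k}P_i\right)$. A depth $k$ ubergraph $U$ is a pair $(V,E)$ where $V$ is a finite set of "fundamental vertices" and $E\subseteq\mathcal{P}(V)^k$ is a finite set of "uberedges", subject to the requirement that whenever some $s\notin V$ is an element of an uberedge, then $s$ is itself an uberedge (i.e. $s\in E$). Thus uberedges may contain fundamental vertices as well as other uberedges as elements. The fundamental vertices and uberedges are regarded as disjoint. The uber-Levi graph of $U=(V,E)$ is the directed graph whose vertex set is $V\cup E$ (one node for each fundamental vertex and one for each uberedge), with a directed arc from $x$ to $y$ if and only if $x\in y$. Two ubergraphs $U=(V,E)$ and $U'=(V',E')$ are isomorphic if there is a bijection $\varphi:V\to V'$ such that, extending $\varphi$ recursively to uberedges by $\varphi(e):=\{\varphi(x)\mid x\in e\}$, one has $e\in E$ if and only if $\varphi(e)\in E'$. -}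

module Defs where

open import Data.Nat using (ℕ)
open import Data.Fin using (Fin)
open import Data.List using (List; []; _∷_; length; lookup)
open import Data.List.Relation.Unary.All using (All)
open import Data.List.Relation.Unary.Any using (Any)
open import Data.List.Relation.Unary.AllPairs using (AllPairs)
open import Data.Sum using (_⊎_; inj₁; inj₂)
open import Data.Product using (Σ; ∃; _×_)
open import Data.Empty using (⊥)
open import Relation.Nullary using (¬_)
open import Relation.Binary.PropositionalEquality using (_≡_)
open import Function.Bundles using (_↔_; _⇔_; Inverse)

-- Hereditarily finite sets over a set of atoms A (the fundamental
-- vertices).  A set is presented by a list of its elements; equality of
-- sets is extensional (defined below), so order and repetition in the
-- list are irrelevant.  Since every term is finite, every such object
-- lies in P(A)^k for some finite k (any depth is allowed).

data HF (A : Set) : Set where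
  atom : A → HF A
  node : List (HF A) → HF A

data _≈_ {A : Set} : HF A → HF A → Set where
  atom≈ : ∀ {a b} → a ≡ b → atom a ≈ atom b
  node≈ : ∀ {xs ys} →
          All (λ x → Any (λ y → x ≈ y) ys) xs →
          All (λ y → Any (λ x → x ≈ y) xs) ys →
          node xs ≈ node ys

data _∈ₕ_ {A : Set} (x : HF A) : HF A → Set where
  mem : ∀ {xs} → Any (λ y → x ≈ y) xs → x ∈ₕ node xs

IsSet : {A : Set} → HF A → Set
IsSet s = ∃ λ xs → s ≡ node xs

NonEmptySet : {A : Set} → HF A → Set
NonEmptySet s = IsSet s × ∃ λ x → x ∈ₕ s

_∈E_ : {A : Set} → HF A → List (HF A) → Set
e ∈E E = Any (λ f → e ≈ f) E

-- The fundamental vertex set is V = Fin n (any finite set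
-- is in bijection with some Fin n); the uberedges are a finite set of
-- hereditarily finite sets over V, given as a duplicate-free list.

record Ubergraph : Set where
  field
    n        : ℕ
    edges    : List (HF (Fin n))
    edgeSets : All IsSet edges
    distinct : AllPairs (λ e f → ¬ (e ≈ f)) edges
    closed   : All (λ e → ∀ xs → node xs ∈ₕ e → node xs ∈E edges) edges

open Ubergraph public

mutual
  mapHF : {A B : Set} → (A → B) → HF A → HF B
  mapHF f (atom a)  = atom (f a)
  mapHF f (node xs) = node (mapHFs f xs)

  mapHFs : {A B : Set} → (A → B) → List (HF A) → List (HF B)
  mapHFs f []       = []
  mapHFs f (x ∷ xs) = mapHF f x ∷ mapHFs f xs

UberIso : Ubergraph → Ubergraph → Set
UberIso U U' =
  Σ (Fin (n U) ↔ Fin (n U')) λ φ →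
    ∀ (e : HF (Fin (n U))) →
      (e ∈E edges U) ⇔ (mapHF (Inverse.to φ) e ∈E edges U')

record DiGraph : Set₁ where
  field
    Vert : Set
    Arc  : Vert → Vert → Set

open DiGraph public

DiIso : DiGraph → DiGraph → Set
DiIso G H =
  Σ (Vert G ↔ Vert H) λ f →
    ∀ x y → Arc G x y ⇔ Arc H (Inverse.to f x) (Inverse.to f y)

-- The uber-Levi graph: one node per fundamental vertex (inj₁) and one
-- per uberedge (inj₂, indexed by position in the edge list), with an
-- arc x → y iff x ∈ y.

LeviVert : Ubergraph → Set
LeviVert U = Fin (n U) ⊎ Fin (length (edges U))

leviObj : (U : Ubergraph) → LeviVert U → HF (Fin (n U))
leviObj U (inj₁ v) = atom v
leviObj U (inj₂ i) = lookup (edges U) i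

LeviArc : (U : Ubergraph) → LeviVert U → LeviVert U → Set
LeviArc U x (inj₁ v) = ⊥
LeviArc U x (inj₂ j) = leviObj U x ∈ₕ lookup (edges U) j

UberLevi : Ubergraph → DiGraph
UberLevi U = record { Vert = LeviVert U ; Arc = LeviArc U }

-- An ubergraph isomorphism φ induces a bijection g between the uberedges with
-- φ(e_j) = e′_(g j), and φ ⊎ g is then an isomorphism of the uber-Levi graphs.
-- Conversely, non-empty uberedges have in-arcs while fundamental vertices have
-- none, so a Levi isomorphism splits as φ ⊎ g.  That φ(e_j) = e′_(g j) follows
-- by induction on e_j: the elements of an uberedge are exactly the objects of
-- its in-neighbours, and the isomorphism carries the in-neighbours of e_j onto
-- those of e′_(g j).
module Submission where

open import Defs
open import Data.Fin using (Fin; zero; suc)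
open import Data.List using (List; []; _∷_; length; lookup; map)
open import Data.List.Membership.Propositional using (_∈_; find; lose)
open import Data.List.Membership.Propositional.Properties using (∈-lookup)
import Data.List.Membership.Setoid as SetoidMembership
import Data.List.Membership.Setoid.Properties as ∈ₛ
open import Data.List.Relation.Unary.All as All using (All; []; _∷_)
open import Data.List.Relation.Unary.Any as Any using (Any; here; there)
import Data.List.Relation.Unary.Any.Properties as Any
open import Data.List.Relation.Unary.AllPairs using (_∷_)
open import Data.List.Relation.Unary.Unique.Setoid using (Unique)
open import Data.Product using (Σ; ∃; _×_; _,_; proj₁; proj₂)
open import Data.Sum using (_⊎_; inj₁; inj₂)
open import Data.Sum.Function.Propositional using (_⊎-↔_)
open import Data.Sum.Properties using (inj₁-injective; inj₂-injective)
open import Function using (_∘_)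
open import Function.Bundles using (_↔_; _⇔_; Inverse; Injection; Equivalence; mk⇔; mk↔ₛ′)
open import Function.Definitions using (Injective)
open import Function.Properties.Inverse using (↔-sym; Inverse⇒Injection)
import Function.Properties.Equivalence as ⇔
open import Relation.Binary.Bundles using (Setoid)
import Relation.Binary.Reasoning.Setoid as SetoidReasoning
open import Relation.Binary.PropositionalEquality
  using (_≡_; refl; sym; trans; cong; cong₂; subst; subst₂; module ≡-Reasoning)
open import Relation.Nullary using (¬_; contradiction)

private
  variable
    A B : Set

All-Any-refl : {R : A → A → Set} {xs : List A} →
               All (λ x → R x x) xs → All (λ x → Any (R x) xs) xs
All-Any-refl rs = All.tabulate λ x∈xs → Any.map (λ { refl → All.lookup rs x∈xs }) x∈xs

mutual
  ≈-refl : (x : HF A) → x ≈ x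
  ≈-refl (atom a)  = atom≈ refl
  ≈-refl (node xs) = node≈ (All-Any-refl (≈-refls xs)) (All-Any-refl (≈-refls xs))

  ≈-refls : (xs : List (HF A)) → All (λ x → x ≈ x) xs
  ≈-refls []       = []
  ≈-refls (x ∷ xs) = ≈-refl x ∷ ≈-refls xs

-- Symmetry and transitivity both follow from x ≈ y → x ≈ z → y ≈ z, whose
-- proof never has to turn a nested equation around.
mutual
  ≈-euclidean : {x y z : HF A} → x ≈ y → x ≈ z → y ≈ z
  ≈-euclidean (atom≈ refl) (atom≈ refl) = atom≈ refl
  ≈-euclidean (node≈ xs⊑ys ys⊑xs) (node≈ xs⊑zs zs⊑xs) =
    node≈ (All-euclidean ys⊑xs xs⊑zs) (All-euclidean′ zs⊑xs xs⊑ys)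

  All-euclidean : {xs ys zs : List (HF A)} →
                  All (λ y → Any (_≈ y) xs) ys → All (λ x → Any (x ≈_) zs) xs →
                  All (λ y → Any (y ≈_) zs) ys
  All-euclidean []       _  = []
  All-euclidean (p ∷ ps) qs = Any-euclidean p qs ∷ All-euclidean ps qs

  Any-euclidean : {y : HF A} {xs zs : List (HF A)} →
                  Any (_≈ y) xs → All (λ x → Any (x ≈_) zs) xs → Any (y ≈_) zs
  Any-euclidean (here x≈y) (q ∷ _)  = Any-euclideanˡ x≈y q
  Any-euclidean (there p)  (_ ∷ qs) = Any-euclidean p qs

  Any-euclideanˡ : {x y : HF A} {zs : List (HF A)} → x ≈ y → Any (x ≈_) zs → Any (y ≈_) zs
  Any-euclideanˡ x≈y (here x≈z) = here (≈-euclidean x≈y x≈z)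
  Any-euclideanˡ x≈y (there p)  = there (Any-euclideanˡ x≈y p)

  All-euclidean′ : {xs ys zs : List (HF A)} →
                   All (λ z → Any (_≈ z) xs) zs → All (λ x → Any (x ≈_) ys) xs →
                   All (λ z → Any (_≈ z) ys) zs
  All-euclidean′ []       _  = []
  All-euclidean′ (p ∷ ps) qs = Any-euclidean′ p qs ∷ All-euclidean′ ps qs

  Any-euclidean′ : {z : HF A} {xs ys : List (HF A)} →
                   Any (_≈ z) xs → All (λ x → Any (x ≈_) ys) xs → Any (_≈ z) ys
  Any-euclidean′ (here x≈z) (q ∷ _)  = Any-euclideanʳ x≈z q
  Any-euclidean′ (there p)  (_ ∷ qs) = Any-euclidean′ p qs

  Any-euclideanʳ : {x z : HF A} {ys : List (HF A)} → x ≈ z → Any (x ≈_) ys → Any (_≈ z) ys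
  Any-euclideanʳ x≈z (here x≈y) = here (≈-euclidean x≈y x≈z)
  Any-euclideanʳ x≈z (there p)  = there (Any-euclideanʳ x≈z p)

≈-sym : {x y : HF A} → x ≈ y → y ≈ x
≈-sym x≈y = ≈-euclidean x≈y (≈-refl _)

≈-trans : {x y z : HF A} → x ≈ y → y ≈ z → x ≈ z
≈-trans x≈y = ≈-euclidean (≈-sym x≈y)

HF-setoid : Set → Setoid _ _
HF-setoid A = record
  { Carrier       = HF A
  ; _≈_           = _≈_
  ; isEquivalence = record { refl = ≈-refl _ ; sym = ≈-sym ; trans = ≈-trans }
  }

≈-reflexive : {x y : HF A} → x ≡ y → x ≈ y
≈-reflexive refl = ≈-refl _

∈⇒∈ₕ : {x : HF A} {xs : List (HF A)} → x ∈ xs → x ∈ₕ node xs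
∈⇒∈ₕ x∈xs = mem (Any.map ≈-reflexive x∈xs)

∈ₕ-node⁻ : {x : HF A} {xs : List (HF A)} → x ∈ₕ node xs → x ∈E xs
∈ₕ-node⁻ (mem x∈xs) = x∈xs

∈ₕ-respˡ : {x y s : HF A} → x ≈ y → x ∈ₕ s → y ∈ₕ s
∈ₕ-respˡ x≈y (mem x∈xs) = mem (∈ₛ.∈-resp-≈ (HF-setoid _) x≈y x∈xs)

∈ₕ-respʳ : {x s t : HF A} → s ≈ t → x ∈ₕ s → x ∈ₕ t
∈ₕ-respʳ (node≈ xs⊑ys _) (mem x∈xs) =
  mem (All.lookupₛ (HF-setoid _) (∈ₛ.∈-resp-≈ (HF-setoid _)) xs⊑ys x∈xs)

∈ₕ-resp-≈ : {x x′ s s′ : HF A} → x ≈ x′ → s ≈ s′ → x ∈ₕ s ⇔ x′ ∈ₕ s′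
∈ₕ-resp-≈ x≈x′ s≈s′ = mk⇔ (∈ₕ-respˡ x≈x′ ∘ ∈ₕ-respʳ s≈s′)
                          (∈ₕ-respˡ (≈-sym x≈x′) ∘ ∈ₕ-respʳ (≈-sym s≈s′))

_⊆ₕ_ : HF A → HF A → Set
s ⊆ₕ t = ∀ {x} → x ∈ₕ s → x ∈ₕ t

≈-ext : {s t : HF A} → IsSet s → IsSet t → s ⊆ₕ t → t ⊆ₕ s → s ≈ t
≈-ext (_ , refl) (_ , refl) s⊆t t⊆s =
  node≈ (elements s⊆t) (All.map (Any.map ≈-sym) (elements t⊆s))
  where
  elements : {xs ys : List (HF A)} → node xs ⊆ₕ node ys → All (_∈E ys) xs
  elements xs⊆ys = All.tabulate (∈ₕ-node⁻ ∘ xs⊆ys ∘ ∈⇒∈ₕ)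

atom≉set : {a : A} {s : HF A} → IsSet s → ¬ atom a ≈ s
atom≉set (_ , refl) ()

module _ (f : A → B) where

  mutual
    mapHF-cong : {x y : HF A} → x ≈ y → mapHF f x ≈ mapHF f y
    mapHF-cong (atom≈ refl)        = atom≈ refl
    mapHF-cong (node≈ xs⊑ys ys⊑xs) = node≈ (mapHF-All∈E xs⊑ys) (mapHF-All∋E ys⊑xs)

    mapHF-All∈E : {xs ys : List (HF A)} →
                All (_∈E ys) xs → All (_∈E mapHFs f ys) (mapHFs f xs)
    mapHF-All∈E []       = []
    mapHF-All∈E (p ∷ ps) = mapHF-∈E p ∷ mapHF-All∈E ps

    mapHF-∈E : {x : HF A} {ys : List (HF A)} → x ∈E ys → mapHF f x ∈E mapHFs f ys
    mapHF-∈E (here x≈y) = here (mapHF-cong x≈y)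
    mapHF-∈E (there p)  = there (mapHF-∈E p)

    mapHF-All∋E : {xs ys : List (HF A)} →
                 All (λ y → Any (_≈ y) xs) ys →
                 All (λ y → Any (_≈ y) (mapHFs f xs)) (mapHFs f ys)
    mapHF-All∋E []       = []
    mapHF-All∋E (p ∷ ps) = mapHF-∋E p ∷ mapHF-All∋E ps

    mapHF-∋E : {y : HF A} {xs : List (HF A)} →
                 Any (_≈ y) xs → Any (_≈ mapHF f y) (mapHFs f xs)
    mapHF-∋E (here x≈y) = here (mapHF-cong x≈y)
    mapHF-∋E (there p)  = there (mapHF-∋E p)

  mapHF-∈ₕ : {x s : HF A} → x ∈ₕ s → mapHF f x ∈ₕ mapHF f s
  mapHF-∈ₕ (mem p) = mem (mapHF-∈E p)

  mapHFs≡map : (xs : List (HF A)) → mapHFs f xs ≡ map (mapHF f) xs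
  mapHFs≡map []       = refl
  mapHFs≡map (x ∷ xs) = cong (mapHF f x ∷_) (mapHFs≡map xs)

  ∈ₕ-mapHF⁻ : {z : HF B} {xs : List (HF A)} →
              z ∈ₕ mapHF f (node xs) → ∃ λ y → y ∈ xs × z ≈ mapHF f y
  ∈ₕ-mapHF⁻ {xs = xs} (mem p) = find (Any.map⁻ (subst (Any _) (mapHFs≡map xs) p))

  ∈ₕ-mapHF⁺ : {z : HF B} {y : HF A} {xs : List (HF A)} →
              y ∈ xs → z ≈ mapHF f y → z ∈ₕ mapHF f (node xs)
  ∈ₕ-mapHF⁺ {xs = xs} y∈xs z≈fy =
    mem (subst (Any _) (sym (mapHFs≡map xs)) (Any.map⁺ (lose y∈xs z≈fy)))

module _ {f : A → B} {g : B → A} (g∘f≗id : ∀ a → g (f a) ≡ a) where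

  mutual
    mapHF-cancel : (x : HF A) → mapHF g (mapHF f x) ≡ x
    mapHF-cancel (atom a)  = cong atom (g∘f≗id a)
    mapHF-cancel (node xs) = cong node (mapHFs-cancel xs)

    mapHFs-cancel : (xs : List (HF A)) → mapHFs g (mapHFs f xs) ≡ xs
    mapHFs-cancel []       = refl
    mapHFs-cancel (x ∷ xs) = cong₂ _∷_ (mapHF-cancel x) (mapHFs-cancel xs)

mapHF-↔ : A ↔ B → Inverse (HF-setoid A) (HF-setoid B)
mapHF-↔ φ = record
  { to        = mapHF (Inverse.to φ)
  ; from      = mapHF (Inverse.from φ)
  ; to-cong   = mapHF-cong (Inverse.to φ)
  ; from-cong = mapHF-cong (Inverse.from φ)
  ; inverse   = (λ {x} y≈ψx → ≈-trans (mapHF-cong _ y≈ψx)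
                                (≈-reflexive (mapHF-cancel (Inverse.strictlyInverseˡ φ) x)))
              , (λ {x} y≈φx → ≈-trans (mapHF-cong _ y≈φx)
                                (≈-reflexive (mapHF-cancel (Inverse.strictlyInverseʳ φ) x)))
  }

mapHF-∈ₕ⇔ : (φ : A ↔ B) {x s : HF A} →
            x ∈ₕ s ⇔ mapHF (Inverse.to φ) x ∈ₕ mapHF (Inverse.to φ) s
mapHF-∈ₕ⇔ φ {x} {s} = mk⇔ (mapHF-∈ₕ _) λ φx∈φs →
  subst₂ _∈ₕ_ (mapHF-cancel ψ∘φ≗id x) (mapHF-cancel ψ∘φ≗id s) (mapHF-∈ₕ (Inverse.from φ) φx∈φs)
  where
  ψ∘φ≗id : ∀ a → Inverse.from φ (Inverse.to φ a) ≡ a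
  ψ∘φ≗id = Inverse.strictlyInverseʳ φ

module _ {c ℓ} (S : Setoid c ℓ) where
  open Setoid S using (Carrier) renaming (_≈_ to _≈ₛ_; sym to ≈ₛ-sym)

  lookup-injective : {xs : List Carrier} → Unique S xs →
                     ∀ i j → lookup xs i ≈ₛ lookup xs j → i ≡ j
  lookup-injective (_  ∷ _)   zero    zero    _  = refl
  lookup-injective (x≉ ∷ _)   zero    (suc j) eq = contradiction eq (All.lookup x≉ (∈-lookup j))
  lookup-injective (x≉ ∷ _)   (suc i) zero    eq = contradiction (≈ₛ-sym eq) (All.lookup x≉ (∈-lookup i))
  lookup-injective (_  ∷ xs!) (suc i) (suc j) eq = cong suc (lookup-injective xs! i j eq)

module _ {c ℓ c′ ℓ′} {S : Setoid c ℓ} {T : Setoid c′ ℓ′} (F : Inverse S T) where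
  private
    module S = Setoid S
    module T = Setoid T
  open SetoidMembership S using () renaming (_∈_ to _∈₁_)
  open SetoidMembership T using () renaming (_∈_ to _∈₂_)
  open Inverse F using (to; from; to-cong; from-cong; strictlyInverseˡ; strictlyInverseʳ)

  Matching : (xs : List S.Carrier) (ys : List T.Carrier) → Fin (length xs) ↔ Fin (length ys) → Set ℓ′
  Matching xs ys g = ∀ i → to (lookup xs i) T.≈ lookup ys (Inverse.to g i)

  ∈⇔⇒matching : {xs : List S.Carrier} {ys : List T.Carrier} → Unique S xs → Unique T ys →
                (∀ x → x ∈₁ xs ⇔ to x ∈₂ ys) → Σ (Fin (length xs) ↔ Fin (length ys)) (Matching xs ys)
  ∈⇔⇒matching {xs} {ys} xs! ys! ∈⇔ =
    mk↔ₛ′ forth back forth∘back back∘forth , Any.lookup-index ∘ image∈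
    where
    image∈ : ∀ i → to (lookup xs i) ∈₂ ys
    image∈ i = Equivalence.to (∈⇔ _) (∈ₛ.∈-lookup S xs i)

    preimage∈ : ∀ k → from (lookup ys k) ∈₁ xs
    preimage∈ k = Equivalence.from (∈⇔ _)
      (∈ₛ.∈-resp-≈ T (T.sym (strictlyInverseˡ _)) (∈ₛ.∈-lookup T ys k))

    forth : Fin (length xs) → Fin (length ys)
    forth = Any.index ∘ image∈

    back : Fin (length ys) → Fin (length xs)
    back = Any.index ∘ preimage∈

    forth∘back : ∀ k → forth (back k) ≡ k
    forth∘back k = lookup-injective T ys! _ _ (begin
      lookup ys (forth (back k))    ≈⟨ Any.lookup-index (image∈ (back k)) ⟨
      to (lookup xs (back k))       ≈⟨ to-cong (Any.lookup-index (preimage∈ k)) ⟨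
      to (from (lookup ys k))       ≈⟨ strictlyInverseˡ _ ⟩
      lookup ys k                   ∎)
      where open SetoidReasoning T

    back∘forth : ∀ i → back (forth i) ≡ i
    back∘forth i = lookup-injective S xs! _ _ (begin
      lookup xs (back (forth i))    ≈⟨ Any.lookup-index (preimage∈ (forth i)) ⟨
      from (lookup ys (forth i))    ≈⟨ from-cong (Any.lookup-index (image∈ i)) ⟨
      from (to (lookup xs i))       ≈⟨ strictlyInverseʳ _ ⟩
      lookup xs i                   ∎)
      where open SetoidReasoning S

  matching⇒∈⇔ : {xs : List S.Carrier} {ys : List T.Carrier} (g : Fin (length xs) ↔ Fin (length ys)) →
                Matching xs ys g → ∀ x → x ∈₁ xs ⇔ to x ∈₂ ys
  matching⇒∈⇔ {xs} {ys} g match x = mk⇔ image∈ preimage∈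
    where
    image∈ : x ∈₁ xs → to x ∈₂ ys
    image∈ x∈xs = ∈ₛ.∈-resp-≈ T (begin
      lookup ys (Inverse.to g i)    ≈⟨ match i ⟨
      to (lookup xs i)              ≈⟨ to-cong (Any.lookup-index x∈xs) ⟨
      to x                          ∎) (∈ₛ.∈-lookup T ys (Inverse.to g i))
      where
      open SetoidReasoning T
      i : Fin (length xs)
      i = Any.index x∈xs

    preimage∈ : to x ∈₂ ys → x ∈₁ xs
    preimage∈ fx∈ys = ∈ₛ.∈-resp-≈ S (S.sym (Injection.injective (Inverse⇒Injection F) (begin
      to x                         ≈⟨ Any.lookup-index fx∈ys ⟩
      lookup ys k                  ≡⟨ cong (lookup ys) (Inverse.strictlyInverseˡ g k) ⟨
      lookup ys (Inverse.to g j)   ≈⟨ match j ⟨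
      to (lookup xs j)             ∎))) (∈ₛ.∈-lookup S xs j)
      where
      open SetoidReasoning T
      k : Fin (length ys)
      k = Any.index fx∈ys
      j : Fin (length xs)
      j = Inverse.from g k

module _ {X Y A A′ : Set} (F : X ↔ Y) {ι : A → X} {ι′ : A′ → Y}
         (ι-injective : Injective _≡_ _≡_ ι) (ι′-injective : Injective _≡_ _≡_ ι′) where
  open Inverse F using (to; from; strictlyInverseˡ; strictlyInverseʳ)

  restrict-↔ : (∀ a → ∃ λ a′ → to (ι a) ≡ ι′ a′) → (∀ a′ → ∃ λ a → from (ι′ a′) ≡ ι a) → A ↔ A′
  restrict-↔ to-ι from-ι′ = mk↔ₛ′ (proj₁ ∘ to-ι) (proj₁ ∘ from-ι′) inverseˡ inverseʳ
    where
    open ≡-Reasoning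

    inverseˡ : ∀ a′ → proj₁ (to-ι (proj₁ (from-ι′ a′))) ≡ a′
    inverseˡ a′ = ι′-injective (begin
      ι′ (proj₁ (to-ι a))  ≡⟨ proj₂ (to-ι a) ⟨
      to (ι a)             ≡⟨ cong to (proj₂ (from-ι′ a′)) ⟨
      to (from (ι′ a′))    ≡⟨ strictlyInverseˡ (ι′ a′) ⟩
      ι′ a′                ∎)
      where
      a : A
      a = proj₁ (from-ι′ a′)

    inverseʳ : ∀ a → proj₁ (from-ι′ (proj₁ (to-ι a))) ≡ a
    inverseʳ a = ι-injective (begin
      ι (proj₁ (from-ι′ a′)) ≡⟨ proj₂ (from-ι′ a′) ⟨
      from (ι′ a′)           ≡⟨ cong from (proj₂ (to-ι a)) ⟨
      from (to (ι a))        ≡⟨ strictlyInverseʳ (ι a) ⟩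
      ι a                    ∎)
      where
      a′ : A′
      a′ = proj₁ (to-ι a)

inj₁↦inj₁ : {A B A′ B′ : Set} (F : (A ⊎ B) ↔ (A′ ⊎ B′)) →
            (∀ b′ → ∃ λ b → Inverse.from F (inj₂ b′) ≡ inj₂ b) →
            ∀ a → ∃ λ a′ → Inverse.to F (inj₁ a) ≡ inj₁ a′
inj₁↦inj₁ F from-inj₂ a with Inverse.to F (inj₁ a) in eq
... | inj₁ a′ = a′ , refl
... | inj₂ b′ = contradiction
        (trans (sym (proj₂ (from-inj₂ b′)))
               (trans (cong (Inverse.from F) (sym eq)) (Inverse.strictlyInverseʳ F (inj₁ a))))
        λ ()

⊎-↔-split : {A B A′ B′ : Set} (F : (A ⊎ B) ↔ (A′ ⊎ B′)) →
            (∀ b → ∃ λ b′ → Inverse.to F (inj₂ b) ≡ inj₂ b′) →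
            (∀ b′ → ∃ λ b → Inverse.from F (inj₂ b′) ≡ inj₂ b) →
            Σ (A ↔ A′) λ f → Σ (B ↔ B′) λ g → ∀ x → Inverse.to F x ≡ Inverse.to (f ⊎-↔ g) x
⊎-↔-split F to-inj₂ from-inj₂ =
  restrict-↔ F inj₁-injective inj₁-injective to-inj₁ from-inj₁ ,
  restrict-↔ F inj₂-injective inj₂-injective to-inj₂ from-inj₂ ,
  λ { (inj₁ a) → proj₂ (to-inj₁ a) ; (inj₂ b) → proj₂ (to-inj₂ b) }
  where
  to-inj₁ : ∀ a → ∃ λ a′ → Inverse.to F (inj₁ a) ≡ inj₁ a′
  to-inj₁ = inj₁↦inj₁ F from-inj₂
  from-inj₁ : ∀ a′ → ∃ λ a → Inverse.from F (inj₁ a′) ≡ inj₁ a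
  from-inj₁ = inj₁↦inj₁ (↔-sym F) to-inj₂

diIso-sym : {G H : DiGraph} → DiIso G H → DiIso H G
diIso-sym {G} {H} (f , arcs) = ↔-sym f , λ x y →
  ⇔.sym (subst₂ (λ u v → Arc G (Inverse.from f x) (Inverse.from f y) ⇔ Arc H u v)
                (Inverse.strictlyInverseˡ f x) (Inverse.strictlyInverseˡ f y)
                (arcs (Inverse.from f x) (Inverse.from f y)))

module _ (U : Ubergraph) where

  edge-isSet : ∀ k → IsSet (lookup (edges U) k)
  edge-isSet k = All.lookup (edgeSets U) (∈-lookup k)

  element⇒inNeighbour : ∀ {y} k → y ∈ₕ lookup (edges U) k →
                        ∃ λ x → LeviArc U x (inj₂ k) × y ≈ leviObj U x
  element⇒inNeighbour {atom a}  k a∈e  = inj₁ a , a∈e , ≈-refl _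
  element⇒inNeighbour {node ys} k ys∈e = inj₂ (Any.index ys∈E) , ∈ₕ-respˡ ys≈ ys∈e , ys≈
    where
    ys∈E : node ys ∈E edges U
    ys∈E = All.lookup (closed U) (∈-lookup k) ys ys∈e
    ys≈ : node ys ≈ lookup (edges U) (Any.index ys∈E)
    ys≈ = Any.lookup-index ys∈E

  nonEmpty⇒inNeighbour : ∀ k → NonEmptySet (lookup (edges U) k) → ∃ λ x → LeviArc U x (inj₂ k)
  nonEmpty⇒inNeighbour k (_ , _ , y∈e) = let x , x→k , _ = element⇒inNeighbour k y∈e in x , x→k

  arc-target-isEdge : ∀ {x y} → LeviArc U x y → ∃ λ k → y ≡ inj₂ k
  arc-target-isEdge {y = inj₂ k} _ = k , refl

edges↦edges : (U U′ : Ubergraph) → All NonEmptySet (edges U) →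
              (f : LeviVert U → LeviVert U′) → (∀ x y → LeviArc U x y → LeviArc U′ (f x) (f y)) →
              ∀ j → ∃ λ k → f (inj₂ j) ≡ inj₂ k
edges↦edges U U′ nonEmpty f f-arc j =
  let x , x→j = nonEmpty⇒inNeighbour U j (All.lookup nonEmpty (∈-lookup j))
  in  arc-target-isEdge U′ (f-arc x (inj₂ j) x→j)

EdgeMatching : Ubergraph → Ubergraph → Set
EdgeMatching U U′ =
  Σ (Fin (n U) ↔ Fin (n U′)) λ φ →
  Σ (Fin (length (edges U)) ↔ Fin (length (edges U′))) (Matching (mapHF-↔ φ) (edges U) (edges U′))

module _ {U U′ : Ubergraph} where

  uberIso⇒edgeMatching : UberIso U U′ → EdgeMatching U U′
  uberIso⇒edgeMatching (φ , ∈⇔) = φ , ∈⇔⇒matching (mapHF-↔ φ) (distinct U) (distinct U′) ∈⇔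

  edgeMatching⇒uberIso : EdgeMatching U U′ → UberIso U U′
  edgeMatching⇒uberIso (φ , g , match) = φ , matching⇒∈⇔ (mapHF-↔ φ) g match

module _ {U U′ : Ubergraph} (φ : Fin (n U) ↔ Fin (n U′))
         (g : Fin (length (edges U)) ↔ Fin (length (edges U′))) where
  private
    E : List (HF (Fin (n U)))
    E = edges U
    E′ : List (HF (Fin (n U′)))
    E′ = edges U′
    F : LeviVert U ↔ LeviVert U′
    F = φ ⊎-↔ g
    φ→ : Fin (n U) → Fin (n U′)
    φ→ = Inverse.to φ
    g→ : Fin (length E) → Fin (length E′)
    g→ = Inverse.to g

  LeviArcsMatch : Set
  LeviArcsMatch = ∀ x y → LeviArc U x y ⇔ LeviArc U′ (Inverse.to F x) (Inverse.to F y)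

  matching⇒leviArcsMatch : Matching (mapHF-↔ φ) E E′ g → LeviArcsMatch
  matching⇒leviArcsMatch match x (inj₁ _) = mk⇔ (λ ()) (λ ())
  matching⇒leviArcsMatch match x (inj₂ j) =
    ⇔.trans (mapHF-∈ₕ⇔ φ) (∈ₕ-resp-≈ (leviObj-image x) (match j))
    where
    leviObj-image : ∀ x → mapHF φ→ (leviObj U x) ≈ leviObj U′ (Inverse.to F x)
    leviObj-image (inj₁ _) = ≈-refl _
    leviObj-image (inj₂ i) = match i

  module _ (arcs : LeviArcsMatch) where

    -- The induction runs over hereditarily finite sets rather than over edges,
    -- since an element of an edge is only extensionally equal to an edge.
    EdgeImage : HF (Fin (n U)) → Set
    EdgeImage y = ∀ k → y ≈ lookup E k → mapHF φ→ y ≈ lookup E′ (g→ k)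

    leviObj-image : ∀ {y} x → EdgeImage y → y ≈ leviObj U x → mapHF φ→ y ≈ leviObj U′ (Inverse.to F x)
    leviObj-image (inj₁ _) _     y≈a  = mapHF-cong φ→ y≈a
    leviObj-image (inj₂ i) y-img y≈Ei = y-img i y≈Ei

    image⊆edge : ∀ {ys k} → All EdgeImage ys → node ys ≈ lookup E k →
                 mapHF φ→ (node ys) ⊆ₕ lookup E′ (g→ k)
    image⊆edge {ys} {k} ys-img ys≈e z∈ =
      let y , y∈ys , z≈φy = ∈ₕ-mapHF⁻ φ→ z∈
          x , x→k , y≈x   = element⇒inNeighbour U k (∈ₕ-respʳ ys≈e (∈⇒∈ₕ y∈ys))
          φy≈x            = leviObj-image x (All.lookup ys-img y∈ys) y≈x
      in  ∈ₕ-respˡ (≈-sym (≈-trans z≈φy φy≈x)) (Equivalence.to (arcs x (inj₂ k)) x→k)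

    edge⊆image : ∀ {ys k} → All EdgeImage ys → node ys ≈ lookup E k →
                 lookup E′ (g→ k) ⊆ₕ mapHF φ→ (node ys)
    edge⊆image {ys} {k} ys-img ys≈e z∈ =
      let x′ , x′→gk , z≈x′ = element⇒inNeighbour U′ (g→ k) z∈
          x                = Inverse.from F x′
          Fx≡x′            = Inverse.strictlyInverseˡ F x′
          x→k              = Equivalence.from (arcs x (inj₂ k))
                               (subst (λ u → LeviArc U′ u (inj₂ (g→ k))) (sym Fx≡x′) x′→gk)
          y , y∈ys , x≈y   = find (∈ₕ-node⁻ (∈ₕ-respʳ (≈-sym ys≈e) x→k))
          φy≈x′            = subst (λ u → mapHF φ→ y ≈ leviObj U′ u) Fx≡x′
                               (leviObj-image x (All.lookup ys-img y∈ys) (≈-sym x≈y))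
      in  ∈ₕ-mapHF⁺ φ→ y∈ys (≈-trans z≈x′ (≈-sym φy≈x′))

    mutual
      edge-image : ∀ y → EdgeImage y
      edge-image (atom a)  k a≈e  = contradiction a≈e (atom≉set (edge-isSet U k))
      edge-image (node ys) k ys≈e = ≈-ext (mapHFs φ→ ys , refl) (edge-isSet U′ (g→ k))
        (image⊆edge (edge-images ys) ys≈e) (edge⊆image (edge-images ys) ys≈e)

      edge-images : ∀ ys → All EdgeImage ys
      edge-images []       = []
      edge-images (y ∷ ys) = edge-image y ∷ edge-images ys

    leviArcsMatch⇒matching : Matching (mapHF-↔ φ) E E′ g
    leviArcsMatch⇒matching j = edge-image (lookup E j) j (≈-refl _)

module _ {U U′ : Ubergraph} where

  edgeMatching⇒leviIso : EdgeMatching U U′ → DiIso (UberLevi U) (UberLevi U′)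
  edgeMatching⇒leviIso (φ , g , match) = (φ ⊎-↔ g) , matching⇒leviArcsMatch φ g match

  leviIso⇒edgeMatching : All NonEmptySet (edges U) → All NonEmptySet (edges U′) →
                         DiIso (UberLevi U) (UberLevi U′) → EdgeMatching U U′
  leviIso⇒edgeMatching nonEmpty nonEmpty′ (T , arcs) =
    let T⁻¹ , arcs⁻¹ = diIso-sym {UberLevi U} {UberLevi U′} (T , arcs)
        φ , g , T≗ = ⊎-↔-split T
          (edges↦edges U U′ nonEmpty (Inverse.to T) λ x y → Equivalence.to (arcs x y))
          (edges↦edges U′ U nonEmpty′ (Inverse.to T⁻¹) λ x y → Equivalence.to (arcs⁻¹ x y))
    in  φ , g , leviArcsMatch⇒matching φ g λ x y →
          subst₂ (λ u v → LeviArc U x y ⇔ LeviArc U′ u v) (T≗ x) (T≗ y) (arcs x y)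

mainTheorem1 : (U U' : Ubergraph) →
    All NonEmptySet (edges U) → All NonEmptySet (edges U') →
    UberIso U U' ⇔ DiIso (UberLevi U) (UberLevi U')
mainTheorem1 U U' nonEmpty nonEmpty' =
  mk⇔ (edgeMatching⇒leviIso ∘ uberIso⇒edgeMatching {U} {U'})
      (edgeMatching⇒uberIso {U} {U'} ∘ leviIso⇒edgeMatching nonEmpty nonEmpty')
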